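{- Let $M$ be a monad on $\mathbf{Set}$ and $(\mathcal{A},\cdot)$ a monadic applicative structure over $M$. Then $\mathcal{A}$ admits the structure of a monadic combinatory algebra (i.e. codes $\langle\lambda^n.e\rangle$ satisfying the MCA laws) if and only if there exist codes $\mathsf{S},\mathsf{K}\in\mathcal{A}$ and, for all $c_1,c_2\in\mathcal{A}$, codes $\mathsf{S}(c_1),\mathsf{S}(c_1,c_2),\mathsf{K}(c_1)\in\mathcal{A}$, such that for all $c_1,c_2,c_3\in\mathcal{A}$: $\mathsf{S}\cdot c_1=\eta(\mathsf{S}(c_1))$, $\mathsf{K}\cdot c_1=\eta(\mathsf{K}(c_1))$, $\mathsf{S}(c_1)\cdot c_2=\eta(\mathsf{S}(c_1,c_2))$, $\mathsf{K}(c_1)\cdot c_2=\eta(c_1)$, and $\mathsf{S}(c_1,c_2)\cdot c_3=\nu((c_1\bullet c_3)\bullet(c_2\bullet c_3))$.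
   Context: $(M,\eta,\mu)$ is a monad on $\mathbf{Set}$; write $\mathrm{let}\ x\Leftarrow m\ \mathrm{in}\ g(x):=\mu(Mg(m))$. A monadic applicative structure (MAS) over $M$ is a set $\mathcal{A}$ of codes with a map $\cdot:\mathcal{A}\times\mathcal{A}\to M\mathcal{A}$. Expressions are $e::= i\in\mathbb{N}\mid c\in\mathcal{A}\mid e\bullet e$ ($\bullet$ left associative); $E_n(\mathcal{A})$ is the set of expressions all of whose variables are $<n$. Substitution $e[c]$: $0[c]=c$, $(i+1)[c]=i$, $c'[c]=c'$, $(e_1\bullet e_2)[c]=e_1[c]\bullet e_2[c]$. Evaluation $\nu:E_0(\mathcal{A})\to M\mathcal{A}$: $\nu(c)=\eta(c)$, $\nu(e_f\bullet e_a)=\mathrm{let}\ c_f\Leftarrow\nu(e_f)\ \mathrm{in}\ \mathrm{let}\ c_a\Leftarrow\nu(e_a)\ \mathrm{in}\ c_f\cdot c_a$. An MCA is an MAS with a code $\langle\lambda^n.e\rangle\in\mathcal{A}$ for each $n\in\mathbb{N}$ and $e\in E_{n+1}(\mathcal{A})$ such that $\langle\lambda^{n+1}.e\rangle\cdot c=\eta(\langle\lambda^n.e[c]\rangle)$ for all $e\in E_{n+2}(\mathcal{A})$, $c\in\mathcal{A}$, and $\langle\lambda^0.e\rangle\cdot c=\nu(e[c])$ for all $e\in E_1(\mathcal{A})$, $c\in\mathcal{A}$. -}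

module Defs where

open import Data.Nat using (ℕ; zero; suc)
open import Data.Fin using (Fin; zero; suc)
open import Data.Product using (Σ; Σ-syntax; _×_)
open import Relation.Binary.PropositionalEquality using (_≡_)

-- Equalities of morphisms in Set are stated pointwise; since Agda lacks
-- function extensionality, we also require that fmap respects pointwise
-- equality (automatic for a functor on the category Set).
record Monad : Set₁ where
  field
    M       : Set → Set
    fmap    : {X Y : Set} → (X → Y) → M X → M Y
    η       : {X : Set} → X → M X
    μ       : {X : Set} → M (M X) → M X
    fmap-cong : {X Y : Set} {f g : X → Y} → (∀ x → f x ≡ g x) → ∀ m → fmap f m ≡ fmap g m
    fmap-id : {X : Set} (m : M X) → fmap (λ x → x) m ≡ m
    fmap-∘  : {X Y Z : Set} (g : Y → Z) (f : X → Y) (m : M X) →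
              fmap (λ x → g (f x)) m ≡ fmap g (fmap f m)
    η-natural : {X Y : Set} (f : X → Y) (x : X) → fmap f (η x) ≡ η (f x)
    μ-natural : {X Y : Set} (f : X → Y) (m : M (M X)) →
                fmap f (μ m) ≡ μ (fmap (fmap f) m)
    μ-η      : {X : Set} (m : M X) → μ (η m) ≡ m
    μ-fmapη  : {X : Set} (m : M X) → μ (fmap η m) ≡ m
    μ-assoc  : {X : Set} (m : M (M (M X))) → μ (μ m) ≡ μ (fmap μ m)

  letM : {X Y : Set} → M X → (X → M Y) → M Y
  letM m g = μ (fmap g m)

module _ (Mon : Monad) (A : Set) (_·_ : A → A → Monad.M Mon A) where
  open Monad Mon

  infixl 5 _•_

  data Exp (n : ℕ) : Set where
    var  : Fin n → Exp n
    code : A → Exp n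
    _•_  : Exp n → Exp n → Exp n

  subst : {n : ℕ} → Exp (suc n) → A → Exp n
  subst (var zero)    c = code c
  subst (var (suc i)) c = var i
  subst (code c′)     c = code c′
  subst (e₁ • e₂)     c = subst e₁ c • subst e₂ c

  ν : Exp 0 → M A
  ν (var ())
  ν (code c)    = η c
  ν (e_f • e_a) = letM (ν e_f) (λ c_f → letM (ν e_a) (λ c_a → c_f · c_a))

  record MCAStructure : Set where
    field
      lam     : (n : ℕ) → Exp (suc n) → A
      lam-suc : (n : ℕ) (e : Exp (suc (suc n))) (c : A) →
                lam (suc n) e · c ≡ η (lam n (subst e c))
      lam-zero : (e : Exp 1) (c : A) → lam 0 e · c ≡ ν (subst e c)

  record SKStructure : Set where
    field
      S  : A
      K  : A
      S₁ : A → A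
      S₂ : A → A → A
      K₁ : A → A
      S-law  : (c₁ : A) → S · c₁ ≡ η (S₁ c₁)
      K-law  : (c₁ : A) → K · c₁ ≡ η (K₁ c₁)
      S₁-law : (c₁ c₂ : A) → S₁ c₁ · c₂ ≡ η (S₂ c₁ c₂)
      K₁-law : (c₁ c₂ : A) → K₁ c₁ · c₂ ≡ η c₁
      S₂-law : (c₁ c₂ c₃ : A) →
               S₂ c₁ c₂ · c₃ ≡ ν ((code c₁ • code c₃) • (code c₂ • code c₃))

{-# OPTIONS --safe #-}
module Submission where

-- An MCA yields S, K and their partial applications as the evident λ-codes,
-- e.g. K = ⟨λ¹.x₀⟩ and S(c₁,c₂) = ⟨λ⁰.(c₁ x₀)(c₂ x₀)⟩.  Conversely, ⟨λⁿ.e⟩ is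
-- given by Curry's bracket abstraction, removing the variables of e from the
-- innermost one.  The result is built from codes by S(_,_) and K(_) alone, so
-- applying it is effect-free (the laws of S, S(c₁), K and K(c₁) return η)
-- until the last abstraction, where the S(c₁,c₂)-law re-evaluates e.  The
-- λⁿ⁺¹-law holds because abstracting the innermost variable commutes with
-- instantiating the outermost one.

open import Defs
open import Function.Bundles using (_⇔_; mk⇔)
open import Data.Nat using (ℕ; zero; suc)
open import Data.Fin using (Fin; zero; suc)
open import Data.Maybe using (Maybe; nothing; just; maybe′)
import Data.Maybe as Maybe
open import Relation.Binary.PropositionalEquality
  using (_≡_; refl; trans; cong; cong₂; module ≡-Reasoning)

module _ (Mon : Monad) where
  open Monad Mon

  letM-η : {X Y : Set} (x : X) (g : X → M Y) → letM (η x) g ≡ g x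
  letM-η x g = trans (cong μ (η-natural g x)) (μ-η (g x))

lower₁? : {n : ℕ} → Fin (suc n) → Maybe (Fin n)
lower₁? {zero}  zero    = nothing
lower₁? {suc n} zero    = just zero
lower₁? {suc n} (suc i) = Maybe.map suc (lower₁? i)

module _ (Mon : Monad) (A : Set) (_·_ : A → A → Monad.M Mon A) where
  open Monad Mon

  mca⇒sk : MCAStructure Mon A _·_ → SKStructure Mon A _·_
  mca⇒sk mca = record
    { S      = lam 2 ((x₀ • x₂) • (x₁ • x₂))
    ; K      = lam 1 x₀
    ; S₁     = λ c₁ → lam 1 ((code c₁ • x₁) • (x₀ • x₁))
    ; S₂     = λ c₁ c₂ → lam 0 ((code c₁ • x₀) • (code c₂ • x₀))
    ; K₁     = λ c₁ → lam 0 (code c₁)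
    ; S-law  = λ c₁ → lam-suc 1 _ c₁
    ; K-law  = λ c₁ → lam-suc 0 _ c₁
    ; S₁-law = λ c₁ c₂ → lam-suc 0 _ c₂
    ; K₁-law = λ c₁ c₂ → lam-zero _ c₂
    ; S₂-law = λ c₁ c₂ c₃ → lam-zero _ c₃
    }
    where
    open MCAStructure mca
    x₀ : {n : ℕ} → Exp Mon A _·_ (suc n)
    x₁ : {n : ℕ} → Exp Mon A _·_ (suc (suc n))
    x₂ : {n : ℕ} → Exp Mon A _·_ (suc (suc (suc n)))
    x₀ = var zero
    x₁ = var (suc zero)
    x₂ = var (suc (suc zero))

  module BracketAbstraction (sk : SKStructure Mon A _·_) where
    open SKStructure sk

    Expr : ℕ → Set
    Expr = Exp Mon A _·_

    _[_]ᵉ : {n : ℕ} → Expr (suc n) → A → Expr n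
    _[_]ᵉ = subst Mon A _·_

    eval : Expr 0 → M A
    eval = ν Mon A _·_

    infixl 5 _⊛_

    _⊛_ : M A → M A → M A
    m ⊛ n = letM m (λ f → letM n (λ a → f · a))

    η-⊛-η : (a b : A) → η a ⊛ η b ≡ a · b
    η-⊛-η a b = trans (letM-η Mon a _) (letM-η Mon b _)

    S₂-· : (a b c : A) → S₂ a b · c ≡ (a · c) ⊛ (b · c)
    S₂-· a b c = trans (S₂-law a b c) (cong₂ _⊛_ (η-⊛-η a c) (η-⊛-η b c))

    S₂-·-η : {a b c x y : A} → a · c ≡ η x → b · c ≡ η y → S₂ a b · c ≡ x · y
    S₂-·-η {a} {b} {c} {x} {y} ac bc = begin
      S₂ a b · c          ≡⟨ S₂-· a b c ⟩
      (a · c) ⊛ (b · c)   ≡⟨ cong₂ _⊛_ ac bc ⟩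
      η x ⊛ η y           ≡⟨ η-⊛-η x y ⟩
      x · y               ∎
      where open ≡-Reasoning

    I : A
    I = S₂ K K

    I-· : (c : A) → I · c ≡ η c
    I-· c = trans (S₂-·-η (K-law c) (K-law c)) (K₁-law c (K₁ c))

    data Term (n : ℕ) : Set where
      var   : Fin n → Term n
      code  : A → Term n
      S⟨_,_⟩ : Term n → Term n → Term n
      K⟨_⟩   : Term n → Term n

    ⟦_⟧ : Term 0 → A
    ⟦ var () ⟧
    ⟦ code c ⟧     = c
    ⟦ S⟨ t , u ⟩ ⟧ = S₂ ⟦ t ⟧ ⟦ u ⟧
    ⟦ K⟨ t ⟩ ⟧     = K₁ ⟦ t ⟧

    _[_] : {n : ℕ} → Term (suc n) → A → Term n
    var zero    [ c ] = code c
    var (suc i) [ c ] = var i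
    code c′     [ c ] = code c′
    S⟨ t , u ⟩  [ c ] = S⟨ t [ c ] , u [ c ] ⟩
    K⟨ t ⟩      [ c ] = K⟨ t [ c ] ⟩

    -- Instantiation replaces variable 0, so ⟨λⁿ.e⟩ must bind it outermost:
    -- bracket abstraction removes the top variable.
    ƛ-var : {n : ℕ} → Fin (suc n) → Term n
    ƛ-var i = maybe′ (λ j → K⟨ var j ⟩) (code I) (lower₁? i)

    ƛ_ : {n : ℕ} → Term (suc n) → Term n
    ƛ var i      = ƛ-var i
    ƛ code c     = K⟨ code c ⟩
    ƛ S⟨ t , u ⟩ = S⟨ S⟨ K⟨ code S ⟩ , ƛ t ⟩ , ƛ u ⟩
    ƛ K⟨ t ⟩     = S⟨ K⟨ code K ⟩ , ƛ t ⟩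

    ƛᵉ_ : {n : ℕ} → Expr (suc n) → Term n
    ƛᵉ var i     = ƛ-var i
    ƛᵉ code c    = K⟨ code c ⟩
    ƛᵉ (e₁ • e₂) = S⟨ ƛᵉ e₁ , ƛᵉ e₂ ⟩

    ƛ-· : (t : Term 1) (c : A) → ⟦ ƛ t ⟧ · c ≡ η ⟦ t [ c ] ⟧
    ƛ-· (var zero) c = I-· c
    ƛ-· (code c′)  c = K₁-law c′ c
    ƛ-· S⟨ t , u ⟩ c = begin
      ⟦ ƛ S⟨ t , u ⟩ ⟧ · c          ≡⟨ S₂-·-η S-part (ƛ-· u c) ⟩
      S₁ ⟦ t [ c ] ⟧ · ⟦ u [ c ] ⟧  ≡⟨ S₁-law _ _ ⟩
      η ⟦ S⟨ t , u ⟩ [ c ] ⟧        ∎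
      where
      open ≡-Reasoning
      S-part : S₂ (K₁ S) ⟦ ƛ t ⟧ · c ≡ η (S₁ ⟦ t [ c ] ⟧)
      S-part = trans (S₂-·-η (K₁-law S c) (ƛ-· t c)) (S-law _)
    ƛ-· K⟨ t ⟩     c = trans (S₂-·-η (K₁-law K c) (ƛ-· t c)) (K-law _)

    ƛᵉ-· : (e : Expr 1) (c : A) → ⟦ ƛᵉ e ⟧ · c ≡ eval (e [ c ]ᵉ)
    ƛᵉ-· (var zero) c = I-· c
    ƛᵉ-· (code c′)  c = K₁-law c′ c
    ƛᵉ-· (e₁ • e₂)  c =
      trans (S₂-· _ _ c) (cong₂ _⊛_ (ƛᵉ-· e₁ c) (ƛᵉ-· e₂ c))

    ƛ-var-suc-[] : {n : ℕ} (i : Fin (suc n)) (c : A) → ƛ-var (suc i) [ c ] ≡ ƛ-var i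
    ƛ-var-suc-[] i c with lower₁? i
    ... | nothing = refl
    ... | just _  = refl

    ƛ-[] : {n : ℕ} (t : Term (suc (suc n))) (c : A) → (ƛ t) [ c ] ≡ ƛ (t [ c ])
    ƛ-[] (var zero)    c = refl
    ƛ-[] (var (suc i)) c = ƛ-var-suc-[] i c
    ƛ-[] (code c′)     c = refl
    ƛ-[] S⟨ t , u ⟩    c =
      cong₂ (λ t′ u′ → S⟨ S⟨ K⟨ code S ⟩ , t′ ⟩ , u′ ⟩) (ƛ-[] t c) (ƛ-[] u c)
    ƛ-[] K⟨ t ⟩        c = cong (λ t′ → S⟨ K⟨ code K ⟩ , t′ ⟩) (ƛ-[] t c)

    ƛᵉ-[] : {n : ℕ} (e : Expr (suc (suc n))) (c : A) → (ƛᵉ e) [ c ] ≡ ƛᵉ (e [ c ]ᵉ)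
    ƛᵉ-[] (var zero)    c = refl
    ƛᵉ-[] (var (suc i)) c = ƛ-var-suc-[] i c
    ƛᵉ-[] (code c′)     c = refl
    ƛᵉ-[] (e₁ • e₂)     c = cong₂ S⟨_,_⟩ (ƛᵉ-[] e₁ c) (ƛᵉ-[] e₂ c)

    close : (n : ℕ) → Term n → A
    close zero    t = ⟦ t ⟧
    close (suc n) t = close n (ƛ t)

    close-· : (n : ℕ) (t : Term (suc n)) (c : A) →
              close (suc n) t · c ≡ η (close n (t [ c ]))
    close-· zero    t c = ƛ-· t c
    close-· (suc n) t c =
      trans (close-· n (ƛ t) c) (cong (λ t′ → η (close n t′)) (ƛ-[] t c))

  sk⇒mca : SKStructure Mon A _·_ → MCAStructure Mon A _·_
  sk⇒mca sk = record
    { lam      = λ n e → close n (ƛᵉ e)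
    ; lam-suc  = λ n e c →
        trans (close-· n (ƛᵉ e) c) (cong (λ t → η (close n t)) (ƛᵉ-[] e c))
    ; lam-zero = ƛᵉ-·
    }
    where open BracketAbstraction sk

proposition2 : (Mon : Monad) (A : Set) (_·_ : A → A → Monad.M Mon A) →
    MCAStructure Mon A _·_ ⇔ SKStructure Mon A _·_
proposition2 Mon A _·_ = mk⇔ (mca⇒sk Mon A _·_) (sk⇒mca Mon A _·_)
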